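{- Let $G\in\mathbb{G}$ have order $n\geq 6$, and let $\mathcal{F}_{G}$ denote the collection of minimal forts of $G$. Then, $\lvert\mathcal{F}_{G}\rvert<\binom{n}{\lfloor n/2\rfloor}$.
   Context: $\mathbb{G}$ denotes the set of all finite simple unweighted graphs; for $G=(V,E)$, $N(u)$ is the neighborhood of $u$. A non-empty subset $F\subseteq V$ is a fort of $G$ if no vertex $u\in V\setminus F$ has exactly one neighbor in $F$. A fort $F$ is minimal if every proper subset of $F$ is not a fort of $G$. Sperner's bound says any clutter (collection of subsets, none containing another) on an $n$-element set has at most $\binom{n}{\lfloor n/2\rfloor}$ sets. -}

module Defs where

open import Data.Nat using (ℕ)
open import Data.Product using (_×_)
open import Data.Fin using (Fin)
open import Data.Fin.Subset using (Subset; _∈_; _∉_; _⊂_; _∩_; ∣_∣; Nonempty)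
open import Relation.Binary.PropositionalEquality using (_≢_)
open import Relation.Nullary using (¬_)

record Graph (n : ℕ) : Set where
  field
    N      : Fin n → Subset n
    irrefl : ∀ u → u ∉ N u
    sym    : ∀ u v → v ∈ N u → u ∈ N v
open Graph public

IsFort : ∀ {n} → Graph n → Subset n → Set
IsFort G F = Nonempty F × (∀ u → u ∉ F → ∣ N G u ∩ F ∣ ≢ 1)

IsMinimalFort : ∀ {n} → Graph n → Subset n → Set
IsMinimalFort G F = IsFort G F × (∀ S → S ⊂ F → ¬ IsFort G S)

-- Minimal forts form an antichain, since a fort strictly inside a minimal fort is impossible, so
-- the theorem is a strict form of Sperner's bound.  Write chains p q for the number of maximal
-- chains of subsets of q through p.  A maximal chain meets an antichain A at most once, hence
-- Σ_{a ∈ A} chains a ⊤ ≤ n!, while chains a ⊤ = |a|! (n - |a|)! ≥ ⌊n/2⌋! ⌈n/2⌉! with equality only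
-- for |a| ∈ {⌊n/2⌋, ⌈n/2⌉}.  So |A| < C(n, ⌊n/2⌋) unless every member has one of these sizes and
-- every maximal chain meets A.
--
-- When all minimal forts have size k = ⌊n/2⌋ or k + 1, a chain through a k-set s and s ∪ {w},
-- neither of them a minimal fort, avoids them all; for n ≥ 6 such s and w exist.  Take a vertex a
-- of minimum degree.  If a is isolated or has a true twin u, then {a} or {a, u} is a fort with
-- fewer than k elements, and any s containing it works.  Otherwise the complement of N(a) is a
-- fort, because a neighbour of a with no other neighbour outside N(a) would be a twin of a.  If
-- this fort has fewer than k elements it again lies inside s.  Otherwise fix a neighbour v of a:
-- in a set of non-neighbours of a together with v, the vertex a has v as its only neighbour, so
-- no such set is a fort.  If the complement of N(a) has exactly k elements, take s = (non-
-- neighbours of a) ∪ {v} and w = a, so that s ∪ {a} strictly contains the fort; if it is larger,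
-- choose both s and s ∪ {w} inside (non-neighbours of a) ∪ {v}.

module Submission where

open import Defs
open import Data.Nat using (ℕ; _<_; _≤_; _/_)
open import Data.Nat.Combinatorics using (_C_)
open import Data.Fin.Subset using (Subset)
open import Data.List using (List; length)
open import Data.List.Relation.Unary.All using (All)
open import Data.List.Relation.Unary.Unique.Propositional using (Unique)

import Data.Bool.Properties as Bool
open import Data.Empty using (⊥-elim)
open import Data.Fin.Base using (Fin; zero; suc; fromℕ<)
open import Data.Fin.Properties using (any?; all?; ¬∀⟶∃¬; punchInᵢ≢i) renaming (_≟_ to _≟ᶠ_)
open import Data.Fin.Subset using (inside; outside; ⊤; ⁅_⁆; _∈_; _∉_; _⊆_; _⊈_; _⊂_; ∁; _∩_; _∪_; _─_; _-_; ∣_∣; Empty)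
open import Data.Fin.Subset.Properties
open import Data.List.Base using (allFin; lookup; _∷_)
open import Data.List.Extrema.Nat using (argmin; f[argmin]≤f[xs])
open import Data.List.Membership.Propositional.Properties using (∈-allFin; ∈-lookup)
import Data.List.Relation.Unary.All as All
open import Data.List.Relation.Unary.AllPairs using (_∷_)
open import Data.Nat.Base using (zero; suc; _+_; _*_; _∸_; _!; z≤n; s≤s; z<s; pred; ⌊_/2⌋; ⌈_/2⌉; NonZero)
open import Data.Nat.Combinatorics using ([n-k]*[n-k-1]!≡[n-k]!; nCk≡n!/k![n-k]!; k![n∸k]!∣n!)
open import Data.Nat.DivMod using (m/n*n≡m; m/n≡1+[m∸n]/n)
open import Data.Nat.Induction using (<-wellFounded)
open import Data.Nat.Properties
open import Algebra.Properties.CommutativeMonoid.Sum +-0-commutativeMonoid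
  using (sum; sum-syntax; ∑-distrib-+; sum-cong-≗; sum-replicate-zero; sum-remove)
open import Algebra.Properties.CommutativeSemigroup *-commutativeSemigroup using (x∙yz≈y∙xz)
open import Data.Product using (∃; ∃!; _×_; _,_; proj₁; proj₂)
import Data.Sum as Sum
open import Data.Sum using (_⊎_; inj₁; inj₂)
open import Data.Vec.Base using ([]; _∷_; here; there)
open import Data.Vec.Functional using (removeAt)
open import Data.Vec.Properties using (≡-dec)
open import Function.Base using (_∘_)
open import Induction.WellFounded using (WellFounded; Acc; acc; module Subrelation)
import Relation.Binary.Construct.On as On
open import Relation.Binary.Definitions using (DecidableEquality; tri<; tri≈; tri>)
import Relation.Binary.PropositionalEquality as ≡
open ≡ using (_≡_; _≢_; refl; trans; cong; subst)
open import Relation.Nullary using (¬_; Dec; yes; no; contradiction)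
open import Relation.Nullary.Decidable using (_×-dec_; _⊎-dec_)

private
  variable
    n : ℕ
    p q : Subset n
    x : Fin n

_≟ˢ_ : DecidableEquality (Subset n)
_≟ˢ_ = ≡-dec Bool._≟_

x∈p─q⇒x∉q : x ∈ p ─ q → x ∉ q
x∈p─q⇒x∉q {p = inside ∷ _} {q = outside ∷ _} here        ()
x∈p─q⇒x∉q {p = _ ∷ _}      {q = outside ∷ _} (there x∈) (there x∈q) = x∈p─q⇒x∉q x∈ x∈q
x∈p─q⇒x∉q {p = _ ∷ _}      {q = inside ∷ _}  (there x∈) (there x∈q) = x∈p─q⇒x∉q x∈ x∈q

x∈p⇒⁅x⁆⊆p : x ∈ p → ⁅ x ⁆ ⊆ p
x∈p⇒⁅x⁆⊆p {p = p} x∈p y∈⁅x⁆ = subst (_∈ p) (≡.sym (x∈⁅y⁆⇒x≡y _ y∈⁅x⁆)) x∈p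

x∈p⇒suc∣p-x∣≡∣p∣ : x ∈ p → suc ∣ p - x ∣ ≡ ∣ p ∣
x∈p⇒suc∣p-x∣≡∣p∣ {p = inside ∷ p}  here         = cong (suc ∘ ∣_∣) (p─⊥≡p p)
x∈p⇒suc∣p-x∣≡∣p∣ {p = outside ∷ _} (there x∈p) = x∈p⇒suc∣p-x∣≡∣p∣ x∈p
x∈p⇒suc∣p-x∣≡∣p∣ {p = inside ∷ _}  (there x∈p) = cong suc (x∈p⇒suc∣p-x∣≡∣p∣ x∈p)

x∉p⇒∣p∪⁅x⁆∣≡suc∣p∣ : x ∉ p → ∣ p ∪ ⁅ x ⁆ ∣ ≡ suc ∣ p ∣
x∉p⇒∣p∪⁅x⁆∣≡suc∣p∣ {x = zero}  {p = outside ∷ p} _   = cong suc (cong ∣_∣ (∪-identityʳ p))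
x∉p⇒∣p∪⁅x⁆∣≡suc∣p∣ {x = zero}  {p = inside ∷ _}  x∉p = contradiction here x∉p
x∉p⇒∣p∪⁅x⁆∣≡suc∣p∣ {x = suc _} {p = outside ∷ _} x∉p = x∉p⇒∣p∪⁅x⁆∣≡suc∣p∣ (x∉p ∘ there)
x∉p⇒∣p∪⁅x⁆∣≡suc∣p∣ {x = suc _} {p = inside ∷ _}  x∉p = cong suc (x∉p⇒∣p∪⁅x⁆∣≡suc∣p∣ (x∉p ∘ there))

p⊆q⇒∣q─p∣+∣p∣≡∣q∣ : p ⊆ q → ∣ q ─ p ∣ + ∣ p ∣ ≡ ∣ q ∣
p⊆q⇒∣q─p∣+∣p∣≡∣q∣ {p = []}          {[]}          _   = refl
p⊆q⇒∣q─p∣+∣p∣≡∣q∣ {p = outside ∷ _} {outside ∷ _} p⊆q = p⊆q⇒∣q─p∣+∣p∣≡∣q∣ (drop-∷-⊆ p⊆q)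
p⊆q⇒∣q─p∣+∣p∣≡∣q∣ {p = outside ∷ _} {inside ∷ _}  p⊆q = cong suc (p⊆q⇒∣q─p∣+∣p∣≡∣q∣ (drop-∷-⊆ p⊆q))
p⊆q⇒∣q─p∣+∣p∣≡∣q∣ {p = inside ∷ _}  {outside ∷ _} p⊆q = contradiction (p⊆q here) λ ()
p⊆q⇒∣q─p∣+∣p∣≡∣q∣ {p = inside ∷ p}  {inside ∷ q}  p⊆q =
  trans (+-suc ∣ q ─ p ∣ ∣ p ∣) (cong suc (p⊆q⇒∣q─p∣+∣p∣≡∣q∣ (drop-∷-⊆ p⊆q)))

⊆⇒≡⊎⊂ : p ⊆ q → p ≡ q ⊎ p ⊂ q
⊆⇒≡⊎⊂ {p = []}          {[]}          _   = inj₁ refl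
⊆⇒≡⊎⊂ {p = outside ∷ _} {outside ∷ _} p⊆q = Sum.map (cong (outside ∷_)) s⊂s (⊆⇒≡⊎⊂ (drop-∷-⊆ p⊆q))
⊆⇒≡⊎⊂ {p = outside ∷ _} {inside ∷ _}  p⊆q = inj₂ (out⊂in (drop-∷-⊆ p⊆q))
⊆⇒≡⊎⊂ {p = inside ∷ _}  {outside ∷ _} p⊆q = contradiction (p⊆q here) λ ()
⊆⇒≡⊎⊂ {p = inside ∷ _}  {inside ∷ _}  p⊆q = Sum.map (cong (inside ∷_)) s⊂s (⊆⇒≡⊎⊂ (drop-∷-⊆ p⊆q))

p⊆q∧∣q∣≤∣p∣⇒p≡q : p ⊆ q → ∣ q ∣ ≤ ∣ p ∣ → p ≡ q
p⊆q∧∣q∣≤∣p∣⇒p≡q p⊆q ∣q∣≤∣p∣ with ⊆⇒≡⊎⊂ p⊆q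
... | inj₁ p≡q = p≡q
... | inj₂ p⊂q = contradiction ∣q∣≤∣p∣ (<⇒≱ (p⊂q⇒∣p∣<∣q∣ p⊂q))

p⊆q∧p≢q⇒p⊂q : p ⊆ q → p ≢ q → p ⊂ q
p⊆q∧p≢q⇒p⊂q p⊆q p≢q with ⊆⇒≡⊎⊂ p⊆q
... | inj₁ p≡q = contradiction p≡q p≢q
... | inj₂ p⊂q = p⊂q

p⊆q∧∣p∣<∣q∣⇒p⊂q : p ⊆ q → ∣ p ∣ < ∣ q ∣ → p ⊂ q
p⊆q∧∣p∣<∣q∣⇒p⊂q p⊆q ∣p∣<∣q∣ = p⊆q∧p≢q⇒p⊂q p⊆q λ { refl → <-irrefl refl ∣p∣<∣q∣ }

∃!⇒∣p∣≡1 : ∃! _≡_ (_∈ p) → ∣ p ∣ ≡ 1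
∃!⇒∣p∣≡1 {p = p} (x , x∈p , unique) =
  trans (cong ∣_∣ (⊆-antisym p⊆⁅x⁆ (x∈p⇒⁅x⁆⊆p x∈p))) (∣⁅x⁆∣≡1 x)
  where
  p⊆⁅x⁆ : p ⊆ ⁅ x ⁆
  p⊆⁅x⁆ y∈p = subst (_∈ ⁅ x ⁆) (unique y∈p) (x∈⁅x⁆ x)

∣p∣≡1⇒∃! : ∀ {n} {p : Subset n} → ∣ p ∣ ≡ 1 → ∃! _≡_ (_∈ p)
∣p∣≡1⇒∃! {n = n} {p = p} ∣p∣≡1 with nonempty? p
... | no ∄x = contradiction (trans (≡.sym ∣p∣≡1) (trans (cong ∣_∣ (Empty-unique ∄x)) (∣⊥∣≡0 n))) λ ()
... | yes (x , x∈p) = x , x∈p , λ y∈p → ≡.sym (x∈⁅y⁆⇒x≡y x (subst (_ ∈_) (≡.sym ⁅x⁆≡p) y∈p))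
  where
  ⁅x⁆≡p : ⁅ x ⁆ ≡ p
  ⁅x⁆≡p = p⊆q∧∣q∣≤∣p∣⇒p≡q (x∈p⇒⁅x⁆⊆p x∈p) (≤-reflexive (trans ∣p∣≡1 (≡.sym (∣⁅x⁆∣≡1 x))))

⊂-wellFounded : WellFounded (_⊂_ {n})
⊂-wellFounded = Subrelation.wellFounded p⊂q⇒∣p∣<∣q∣ (On.wellFounded ∣_∣ <-wellFounded)

⊆-fill : ∀ {k} → p ⊆ q → ∣ p ∣ ≤ k → k ≤ ∣ q ∣ → ∃ λ r → p ⊆ r × r ⊆ q × ∣ r ∣ ≡ k
⊆-fill = fill (⊂-wellFounded _)
  where
  fill : ∀ {k} → Acc _⊂_ q → p ⊆ q → ∣ p ∣ ≤ k → k ≤ ∣ q ∣ → ∃ λ r → p ⊆ r × r ⊆ q × ∣ r ∣ ≡ k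
  fill {q = q} {p = p} {k = k} (acc rs) p⊆q ∣p∣≤k k≤∣q∣ with m≤n⇒m<n∨m≡n k≤∣q∣
  ... | inj₂ k≡∣q∣ = q , p⊆q , ⊆-refl , ≡.sym k≡∣q∣
  ... | inj₁ k<∣q∣ = shrink (p⊆q∧∣p∣<∣q∣⇒p⊂q p⊆q (≤-<-trans ∣p∣≤k k<∣q∣))
    where
    shrink : p ⊂ q → ∃ λ r → p ⊆ r × r ⊆ q × ∣ r ∣ ≡ k
    shrink (_ , x , x∈q , x∉p) =
      let r , p⊆r , r⊆q-x , ∣r∣≡k = fill (rs (x∈p⇒p-x⊂p x∈q)) p⊆q-x ∣p∣≤k k≤∣q-x∣
      in  r , p⊆r , ⊆-trans r⊆q-x (p─q⊆p q ⁅ x ⁆) , ∣r∣≡k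
      where
      p⊆q-x : p ⊆ q - x
      p⊆q-x y∈p = x∈p∧x≢y⇒x∈p-y (p⊆q y∈p) λ { refl → x∉p y∈p }
      k≤∣q-x∣ : k ≤ ∣ q - x ∣
      k≤∣q-x∣ = ≤-pred (subst (k <_) (≡.sym (x∈p⇒suc∣p-x∣≡∣p∣ x∈q)) k<∣q∣)

∑-const : ∀ m c → ∑[ i < m ] c ≡ m * c
∑-const zero    c = refl
∑-const (suc m) c = cong (c +_) (∑-const m c)

∑-mono-≤ : ∀ {m} {f g : Fin m → ℕ} → (∀ i → f i ≤ g i) → sum f ≤ sum g
∑-mono-≤ {zero}  _   = z≤n
∑-mono-≤ {suc m} f≤g = +-mono-≤ (f≤g zero) (∑-mono-≤ (f≤g ∘ suc))

∑-mono-< : ∀ {m} {f g : Fin m → ℕ} {j} → (∀ i → f i ≤ g i) → f j < g j → sum f < sum g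
∑-mono-< {j = zero}  f≤g fj<gj = +-mono-<-≤ fj<gj (∑-mono-≤ (f≤g ∘ suc))
∑-mono-< {j = suc j} f≤g fj<gj = +-mono-≤-< (f≤g zero) (∑-mono-< (f≤g ∘ suc) fj<gj)

∑-supported : ∀ {m} {f : Fin m → ℕ} i → (∀ j → j ≢ i → f j ≡ 0) → sum f ≡ f i
∑-supported {suc m} {f} i f≡0 = begin
  sum f                     ≡⟨ sum-remove f ⟩
  f i + sum (removeAt f i)  ≡⟨ cong (f i +_) (sum-cong-≗ (λ j → f≡0 _ (punchInᵢ≢i i j))) ⟩
  f i + ∑[ j < m ] 0        ≡⟨ cong (f i +_) (sum-replicate-zero m) ⟩
  f i + 0                   ≡⟨ +-identityʳ (f i) ⟩
  f i                       ∎
  where open ≡.≡-Reasoning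

∑∈ : Subset n → (Fin n → ℕ) → ℕ
∑∈ []            f = 0
∑∈ (outside ∷ p) f = ∑∈ p (f ∘ suc)
∑∈ (inside ∷ p)  f = f zero + ∑∈ p (f ∘ suc)

infix 10 ∑∈
syntax ∑∈ p (λ x → e) = ∑[ x ∈ p ] e

∑∈-const : ∀ (p : Subset n) c → ∑[ x ∈ p ] c ≡ ∣ p ∣ * c
∑∈-const []            c = refl
∑∈-const (outside ∷ p) c = ∑∈-const p c
∑∈-const (inside ∷ p)  c = cong (c +_) (∑∈-const p c)

∑∈-Empty : ∀ {f} → Empty p → ∑∈ p f ≡ 0
∑∈-Empty {p = []}          _     = refl
∑∈-Empty {p = outside ∷ _} empty = ∑∈-Empty (drop-∷-Empty empty)
∑∈-Empty {p = inside ∷ _}  empty = contradiction (zero , here) empty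

∑∈-mono-≤ : ∀ (p : Subset n) {f g} → (∀ {x} → x ∈ p → f x ≤ g x) → ∑∈ p f ≤ ∑∈ p g
∑∈-mono-≤ []            _   = z≤n
∑∈-mono-≤ (outside ∷ p) f≤g = ∑∈-mono-≤ p (f≤g ∘ there)
∑∈-mono-≤ (inside ∷ p)  f≤g = +-mono-≤ (f≤g here) (∑∈-mono-≤ p (f≤g ∘ there))

∑∈-mono-< : ∀ (p : Subset n) {f g} → (∀ {x} → x ∈ p → f x ≤ g x) → x ∈ p → f x < g x → ∑∈ p f < ∑∈ p g
∑∈-mono-< (inside ∷ p)  f≤g here        fx<gx = +-mono-<-≤ fx<gx (∑∈-mono-≤ p (f≤g ∘ there))
∑∈-mono-< (outside ∷ p) f≤g (there x∈p) fx<gx = ∑∈-mono-< p (f≤g ∘ there) x∈p fx<gx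
∑∈-mono-< (inside ∷ p)  f≤g (there x∈p) fx<gx = +-mono-≤-< (f≤g here) (∑∈-mono-< p (f≤g ∘ there) x∈p fx<gx)

∑∈-mono-⊆ : ∀ f → p ⊆ q → ∑∈ p f ≤ ∑∈ q f
∑∈-mono-⊆ {p = []}          {[]}          f _   = z≤n
∑∈-mono-⊆ {p = outside ∷ _} {outside ∷ _} f p⊆q = ∑∈-mono-⊆ (f ∘ suc) (drop-∷-⊆ p⊆q)
∑∈-mono-⊆ {p = outside ∷ _} {inside ∷ _}  f p⊆q = ≤-trans (∑∈-mono-⊆ (f ∘ suc) (drop-∷-⊆ p⊆q)) (m≤n+m _ (f zero))
∑∈-mono-⊆ {p = inside ∷ _}  {outside ∷ _} f p⊆q = contradiction (p⊆q here) λ ()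
∑∈-mono-⊆ {p = inside ∷ _}  {inside ∷ _}  f p⊆q = +-monoʳ-≤ (f zero) (∑∈-mono-⊆ (f ∘ suc) (drop-∷-⊆ p⊆q))

∑∈-∑-comm : ∀ {m} (p : Subset n) (h : Fin m → Fin n → ℕ) →
            ∑[ x ∈ p ] ∑[ i < m ] h i x ≡ ∑[ i < m ] ∑[ x ∈ p ] h i x
∑∈-∑-comm {m = m} []            h = ≡.sym (sum-replicate-zero m)
∑∈-∑-comm         (outside ∷ p) h = ∑∈-∑-comm p (λ i → h i ∘ suc)
∑∈-∑-comm         (inside ∷ p)  h = trans (cong (∑[ i < _ ] h i zero +_) (∑∈-∑-comm p (λ i → h i ∘ suc)))
                                          (≡.sym (∑-distrib-+ (λ i → h i zero) (λ i → ∑∈ p (h i ∘ suc))))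

-- Products of two factorials with a fixed sum

!*!-shift : ∀ {a b} → a < b → suc a ! * b ! < a ! * suc b !
!*!-shift {a} {b} a<b = begin-strict
  suc a ! * b !        ≡⟨ *-assoc (suc a) (a !) (b !) ⟩
  suc a * (a ! * b !)  <⟨ *-monoˡ-< (a ! * b !) {{a !* b !≢0}} (s≤s a<b) ⟩
  suc b * (a ! * b !)  ≡⟨ x∙yz≈y∙xz (suc b) (a !) (b !) ⟩
  a ! * suc b !        ∎
  where open ≤-Reasoning

!*!-balance-≤ : ∀ c g {b} → c + g ≤ b → (c + g) ! * b ! ≤ c ! * (g + b) !
!*!-balance-< : ∀ c g {b} → c + g ≤ b → 0 < g → (c + g) ! * b ! < c ! * (g + b) !

!*!-balance-≤ c zero    {b} _      = ≤-reflexive (cong (λ a → a ! * b !) (+-identityʳ c))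
!*!-balance-≤ c (suc g)     c+g≤b  = <⇒≤ (!*!-balance-< c (suc g) c+g≤b z<s)

!*!-balance-< c (suc g) {b} c+g≤b _ = begin-strict
  (c + suc g) ! * b !    ≡⟨ cong (λ a → a ! * b !) (+-suc c g) ⟩
  (suc c + g) ! * b !    ≤⟨ !*!-balance-≤ (suc c) g (≤-trans (≤-reflexive (≡.sym (+-suc c g))) c+g≤b) ⟩
  suc c ! * (g + b) !    <⟨ !*!-shift (<-≤-trans (m<m+n c z<s) (≤-trans c+g≤b (m≤n+m b g))) ⟩
  c ! * suc (g + b) !    ∎
  where open ≤-Reasoning

-- For j ≤ e, moving g = ⌊n/2⌋ ∸ j units from e to j reaches the balanced pair (⌊n/2⌋, ⌈n/2⌉).
module _ {j e n : ℕ} (j+e≡n : j + e ≡ n) (j≤e : j ≤ e) where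
  private
    j≤⌊n/2⌋ : j ≤ ⌊ n /2⌋
    j≤⌊n/2⌋ = subst (_≤ ⌊ n /2⌋) (≡.sym (n≡⌊n+n/2⌋ j)) (⌊n/2⌋-mono (subst (j + j ≤_) j+e≡n (+-monoʳ-≤ j j≤e)))

    g : ℕ
    g = ⌊ n /2⌋ ∸ j

    j+g≡⌊n/2⌋ : j + g ≡ ⌊ n /2⌋
    j+g≡⌊n/2⌋ = m+[n∸m]≡n j≤⌊n/2⌋

    g+⌈n/2⌉≡e : g + ⌈ n /2⌉ ≡ e
    g+⌈n/2⌉≡e = +-cancelˡ-≡ j _ _ (begin
      j + (g + ⌈ n /2⌉)  ≡⟨ +-assoc j g _ ⟨
      j + g + ⌈ n /2⌉    ≡⟨ cong (_+ ⌈ n /2⌉) j+g≡⌊n/2⌋ ⟩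
      ⌊ n /2⌋ + ⌈ n /2⌉  ≡⟨ ⌊n/2⌋+⌈n/2⌉≡n n ⟩
      n                  ≡⟨ j+e≡n ⟨
      j + e              ∎)
      where open ≡.≡-Reasoning

    j+g≤⌈n/2⌉ : j + g ≤ ⌈ n /2⌉
    j+g≤⌈n/2⌉ = subst (_≤ ⌈ n /2⌉) (≡.sym j+g≡⌊n/2⌋) (⌊n/2⌋≤⌈n/2⌉ n)

  middle≤!*!-ordered : ⌊ n /2⌋ ! * ⌈ n /2⌉ ! ≤ j ! * e !
  middle≤!*!-ordered = ≡.subst₂ (λ a d → a ! * ⌈ n /2⌉ ! ≤ j ! * d !) j+g≡⌊n/2⌋ g+⌈n/2⌉≡e
                         (!*!-balance-≤ j g j+g≤⌈n/2⌉)

  middle<!*!-ordered : j ≢ ⌊ n /2⌋ → ⌊ n /2⌋ ! * ⌈ n /2⌉ ! < j ! * e !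
  middle<!*!-ordered j≢⌊n/2⌋ = ≡.subst₂ (λ a d → a ! * ⌈ n /2⌉ ! < j ! * d !) j+g≡⌊n/2⌋ g+⌈n/2⌉≡e
                                 (!*!-balance-< j g j+g≤⌈n/2⌉ (m<n⇒0<n∸m (≤∧≢⇒< j≤⌊n/2⌋ j≢⌊n/2⌋)))

middle≤!*! : ∀ {j e n} → j + e ≡ n → ⌊ n /2⌋ ! * ⌈ n /2⌉ ! ≤ j ! * e !
middle≤!*! {j} {e} {n} j+e≡n with ≤-total j e
... | inj₁ j≤e = middle≤!*!-ordered j+e≡n j≤e
... | inj₂ e≤j = subst (⌊ n /2⌋ ! * ⌈ n /2⌉ ! ≤_) (*-comm (e !) (j !))
                       (middle≤!*!-ordered (trans (+-comm e j) j+e≡n) e≤j)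

Middle : ℕ → ℕ → Set
Middle n j = j ≡ ⌊ n /2⌋ ⊎ j ≡ ⌈ n /2⌉

middle? : ∀ n j → Dec (Middle n j)
middle? n j = (j ≟ ⌊ n /2⌋) ⊎-dec (j ≟ ⌈ n /2⌉)

Middle⇒bounds : ∀ {n j} → Middle n j → ⌊ n /2⌋ ≤ j × j ≤ suc ⌊ n /2⌋
Middle⇒bounds {n} (inj₁ refl) = ≤-refl , n≤1+n ⌊ n /2⌋
Middle⇒bounds {n} (inj₂ refl) = ⌊n/2⌋≤⌈n/2⌉ n , ⌈n/2⌉-mono (n≤1+n n)

middle<!*! : ∀ {j e n} → j + e ≡ n → ¬ Middle n j → ⌊ n /2⌋ ! * ⌈ n /2⌉ ! < j ! * e !
middle<!*! {j} {e} {n} j+e≡n ¬middle with ≤-total j e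
... | inj₁ j≤e = middle<!*!-ordered j+e≡n j≤e (¬middle ∘ inj₁)
... | inj₂ e≤j = subst (⌊ n /2⌋ ! * ⌈ n /2⌉ ! <_) (*-comm (e !) (j !))
                       (middle<!*!-ordered (trans (+-comm e j) j+e≡n) e≤j e≢⌊n/2⌋)
  where
  e≢⌊n/2⌋ : e ≢ ⌊ n /2⌋
  e≢⌊n/2⌋ e≡⌊n/2⌋ = ¬middle (inj₂ (+-cancelʳ-≡ ⌊ n /2⌋ j ⌈ n /2⌉ (begin
    j + ⌊ n /2⌋        ≡⟨ cong (j +_) e≡⌊n/2⌋ ⟨
    j + e              ≡⟨ j+e≡n ⟩
    n                  ≡⟨ ⌊n/2⌋+⌈n/2⌉≡n n ⟨
    ⌊ n /2⌋ + ⌈ n /2⌉  ≡⟨ +-comm ⌊ n /2⌋ ⌈ n /2⌉ ⟩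
    ⌈ n /2⌉ + ⌊ n /2⌋  ∎)))
    where open ≡.≡-Reasoning

n/2≡⌊n/2⌋ : ∀ n → n / 2 ≡ ⌊ n /2⌋
n/2≡⌊n/2⌋ zero          = refl
n/2≡⌊n/2⌋ (suc zero)    = refl
n/2≡⌊n/2⌋ (suc (suc n)) = trans (m/n≡1+[m∸n]/n {suc (suc n)} {2} (s≤s (s≤s z≤n))) (cong suc (n/2≡⌊n/2⌋ n))

nC⌊n/2⌋*middle≡n! : ∀ n → (n C ⌊ n /2⌋) * (⌊ n /2⌋ ! * ⌈ n /2⌉ !) ≡ n !
nC⌊n/2⌋*middle≡n! n = begin
  (n C k) * (k ! * ⌈ n /2⌉ !)                  ≡⟨ cong (λ c → (n C k) * (k ! * c !)) n∸k≡⌈n/2⌉ ⟨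
  (n C k) * (k ! * (n ∸ k) !)                  ≡⟨ cong (_* (k ! * (n ∸ k) !)) (nCk≡n!/k![n-k]! k≤n) ⟩
  n ! / (k ! * (n ∸ k) !) * (k ! * (n ∸ k) !)  ≡⟨ m/n*n≡m (k![n∸k]!∣n! k≤n) ⟩
  n !                                          ∎
  where
  open ≡.≡-Reasoning
  k : ℕ
  k = ⌊ n /2⌋
  instance
    k!*[n∸k]!≢0 : NonZero (k ! * (n ∸ k) !)
    k!*[n∸k]!≢0 = k !* (n ∸ k) !≢0
  k≤n : k ≤ n
  k≤n = ⌊n/2⌋≤n n
  n∸k≡⌈n/2⌉ : n ∸ k ≡ ⌈ n /2⌉
  n∸k≡⌈n/2⌉ = trans (cong (_∸ k) (≡.sym (⌊n/2⌋+⌈n/2⌉≡n n))) (m+n∸m≡n k ⌈ n /2⌉)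

-- Maximal chains and the LYM inequality

∑∈∣p-x∣!≤∣p∣! : ∀ (p : Subset n) → ∑[ x ∈ p ] (∣ p - x ∣ !) ≤ ∣ p ∣ !
∑∈∣p-x∣!≤∣p∣! p = begin
  ∑[ x ∈ p ] (∣ p - x ∣ !)    ≤⟨ ∑∈-mono-≤ p (λ x∈p → ≤-reflexive (cong (_! ∘ pred) (x∈p⇒suc∣p-x∣≡∣p∣ x∈p))) ⟩
  ∑[ x ∈ p ] (pred ∣ p ∣ !)   ≡⟨ ∑∈-const p (pred ∣ p ∣ !) ⟩
  ∣ p ∣ * pred ∣ p ∣ !        ≤⟨ n*pred[n]!≤n! ∣ p ∣ ⟩
  ∣ p ∣ !                     ∎
  where
  open ≤-Reasoning
  n*pred[n]!≤n! : ∀ n → n * pred n ! ≤ n !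
  n*pred[n]!≤n! zero    = z≤n
  n*pred[n]!≤n! (suc n) = ≤-refl

-- A maximal chain ∅ ⊂ … ⊂ q through p ⊆ q orders the elements of p, then those of q ─ p.
chains : Subset n → Subset n → ℕ
chains p q with p ⊆? q
... | yes _ = ∣ p ∣ ! * (∣ q ∣ ∸ ∣ p ∣) !
... | no  _ = 0

chains-⊆ : p ⊆ q → chains p q ≡ ∣ p ∣ ! * (∣ q ∣ ∸ ∣ p ∣) !
chains-⊆ {p = p} {q} p⊆q with p ⊆? q
... | yes _   = refl
... | no p⊈q = ⊥-elim (p⊈q p⊆q)

chains-⊈ : p ⊈ q → chains p q ≡ 0
chains-⊈ {p = p} {q} p⊈q with p ⊆? q
... | yes p⊆q = ⊥-elim (p⊈q p⊆q)
... | no _    = refl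

chains-refl : ∀ (p : Subset n) → chains p p ≡ ∣ p ∣ !
chains-refl p = begin
  chains p p                   ≡⟨ chains-⊆ {p = p} ⊆-refl ⟩
  ∣ p ∣ ! * (∣ p ∣ ∸ ∣ p ∣) !   ≡⟨ cong (λ d → ∣ p ∣ ! * d !) (n∸n≡0 ∣ p ∣) ⟩
  ∣ p ∣ ! * 1                   ≡⟨ *-identityʳ (∣ p ∣ !) ⟩
  ∣ p ∣ !                       ∎
  where open ≡.≡-Reasoning

chains-child : p ⊆ q → x ∈ q ─ p → chains p (q - x) ≡ ∣ p ∣ ! * (∣ q ∣ ∸ suc ∣ p ∣) !
chains-child {p = p} {q} {x} p⊆q x∈q─p = begin
  chains p (q - x)                 ≡⟨ chains-⊆ p⊆q-x ⟩
  ∣ p ∣ ! * (∣ q - x ∣ ∸ ∣ p ∣) !  ≡⟨ cong (λ c → ∣ p ∣ ! * (c ∸ suc ∣ p ∣) !) (x∈p⇒suc∣p-x∣≡∣p∣ x∈q) ⟩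
  ∣ p ∣ ! * (∣ q ∣ ∸ suc ∣ p ∣) !  ∎
  where
  open ≡.≡-Reasoning
  x∈q : x ∈ q
  x∈q = p─q⊆p q p x∈q─p
  p⊆q-x : p ⊆ q - x
  p⊆q-x y∈p = x∈p∧x≢y⇒x∈p-y (p⊆q y∈p) λ { refl → x∈p─q⇒x∉q x∈q─p y∈p }

-- A maximal chain of q through p ⊂ q consists of the element x ∈ q ─ p added last and a maximal
-- chain of q - x through p.
chains-≤-∑-children : p ≢ q → chains p q ≤ ∑[ x ∈ q ] chains p (q - x)
chains-≤-∑-children {p = p} {q} p≢q with p ⊆? q
... | no _    = z≤n
... | yes p⊆q = begin
  ∣ p ∣ ! * (∣ q ∣ ∸ ∣ p ∣) !                          ≡⟨ cong (∣ p ∣ ! *_) ([n-k]*[n-k-1]!≡[n-k]! ∣p∣<∣q∣) ⟨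
  ∣ p ∣ ! * ((∣ q ∣ ∸ ∣ p ∣) * (∣ q ∣ ∸ suc ∣ p ∣) !)  ≡⟨ x∙yz≈y∙xz (∣ p ∣ !) (∣ q ∣ ∸ ∣ p ∣) _ ⟩
  (∣ q ∣ ∸ ∣ p ∣) * c                                  ≡⟨ cong (_* c) ∣q─p∣≡∣q∣∸∣p∣ ⟨
  ∣ q ─ p ∣ * c                                        ≡⟨ ∑∈-const (q ─ p) c ⟨
  ∑[ x ∈ q ─ p ] c                                     ≤⟨ ∑∈-mono-≤ (q ─ p) (λ x∈q─p → ≤-reflexive (≡.sym (chains-child p⊆q x∈q─p))) ⟩
  ∑[ x ∈ q ─ p ] chains p (q - x)                      ≤⟨ ∑∈-mono-⊆ (λ x → chains p (q - x)) (p─q⊆p q p) ⟩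
  ∑[ x ∈ q ] chains p (q - x)                          ∎
  where
  open ≤-Reasoning
  c : ℕ
  c = ∣ p ∣ ! * (∣ q ∣ ∸ suc ∣ p ∣) !
  ∣p∣<∣q∣ : ∣ p ∣ < ∣ q ∣
  ∣p∣<∣q∣ = p⊂q⇒∣p∣<∣q∣ (p⊆q∧p≢q⇒p⊂q p⊆q p≢q)
  ∣q─p∣≡∣q∣∸∣p∣ : ∣ q ─ p ∣ ≡ ∣ q ∣ ∸ ∣ p ∣
  ∣q─p∣≡∣q∣∸∣p∣ = trans (≡.sym (m+n∸n≡m ∣ q ─ p ∣ ∣ p ∣)) (cong (_∸ ∣ p ∣) (p⊆q⇒∣q─p∣+∣p∣≡∣q∣ p⊆q))

chains-⊤ : ∀ (p : Subset n) → chains p ⊤ ≡ ∣ p ∣ ! * (n ∸ ∣ p ∣) !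
chains-⊤ {n} p = trans (chains-⊆ {p = p} ⊆⊤) (cong (λ c → ∣ p ∣ ! * (c ∸ ∣ p ∣) !) (∣⊤∣≡n n))

middle≤chains-⊤ : ∀ (p : Subset n) → ⌊ n /2⌋ ! * ⌈ n /2⌉ ! ≤ chains p ⊤
middle≤chains-⊤ {n} p = subst (⌊ n /2⌋ ! * ⌈ n /2⌉ ! ≤_) (≡.sym (chains-⊤ p)) (middle≤!*! {∣ p ∣} {n ∸ ∣ p ∣} (m+[n∸m]≡n (∣p∣≤n p)))

middle<chains-⊤ : ∀ {n} {p : Subset n} → ¬ Middle n ∣ p ∣ → ⌊ n /2⌋ ! * ⌈ n /2⌉ ! < chains p ⊤
middle<chains-⊤ {n} {p} ¬middle =
  subst (⌊ n /2⌋ ! * ⌈ n /2⌉ ! <_) (≡.sym (chains-⊤ p)) (middle<!*! {∣ p ∣} {n ∸ ∣ p ∣} (m+[n∸m]≡n (∣p∣≤n p)) ¬middle)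

module LYM {n m} (A : Fin m → Subset n) where

  Avoids : Subset n → Set
  Avoids p = ∀ i → A i ≢ p

  -- A maximal chain ∅ ⊂ … ⊂ p, listed from the top, none of whose members is in the family.
  data AvoidingChain : Subset n → Set where
    done : ∀ {p} → Empty p → Avoids p → AvoidingChain p
    step : ∀ {p x} → x ∈ p → Avoids p → AvoidingChain (p - x) → AvoidingChain p

  weight : Subset n → ℕ
  weight p = ∑[ i < m ] chains (A i) p

  weight-≤-∑-children : ∀ {p} → Avoids p → weight p ≤ ∑[ x ∈ p ] weight (p - x)
  weight-≤-∑-children {p} p-avoids = begin
    weight p                                    ≤⟨ ∑-mono-≤ (λ i → chains-≤-∑-children (p-avoids i)) ⟩
    ∑[ i < m ] ∑[ x ∈ p ] chains (A i) (p - x)  ≡⟨ ∑∈-∑-comm p (λ i x → chains (A i) (p - x)) ⟨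
    ∑[ x ∈ p ] weight (p - x)                   ∎
    where open ≤-Reasoning

  module _ (antichain : ∀ i j → A i ⊆ A j → i ≡ j) where

    weight-member : ∀ i → weight (A i) ≡ ∣ A i ∣ !
    weight-member i = trans (∑-supported i (λ j j≢i → chains-⊈ (j≢i ∘ antichain j i))) (chains-refl (A i))

    lym : ∀ p → weight p ≤ ∣ p ∣ !
    lym p = lym-acc (⊂-wellFounded p)
      where
      lym-acc : ∀ {p} → Acc _⊂_ p → weight p ≤ ∣ p ∣ !
      lym-acc {p} (acc rs) with any? (λ i → A i ≟ˢ p)
      ... | yes (i , refl) = ≤-reflexive (weight-member i)
      ... | no p-avoids    = begin
        weight p                      ≤⟨ weight-≤-∑-children (λ i Ai≡p → p-avoids (i , Ai≡p)) ⟩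
        ∑[ x ∈ p ] weight (p - x)     ≤⟨ ∑∈-mono-≤ p (λ x∈p → lym-acc (rs (x∈p⇒p-x⊂p x∈p))) ⟩
        ∑[ x ∈ p ] (∣ p - x ∣ !)      ≤⟨ ∑∈∣p-x∣!≤∣p∣! p ⟩
        ∣ p ∣ !                       ∎
        where open ≤-Reasoning

    lym-< : ∀ {p} → AvoidingChain p → weight p < ∣ p ∣ !
    lym-< {p} (done p-empty p-avoids) = begin-strict
      weight p                   ≤⟨ weight-≤-∑-children p-avoids ⟩
      ∑[ x ∈ p ] weight (p - x)  ≡⟨ ∑∈-Empty p-empty ⟩
      0                          <⟨ 1≤n! ∣ p ∣ ⟩
      ∣ p ∣ !                    ∎
      where open ≤-Reasoning
    lym-< {p} (step x∈p p-avoids chain) = begin-strict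
      weight p                   ≤⟨ weight-≤-∑-children p-avoids ⟩
      ∑[ y ∈ p ] weight (p - y)  <⟨ ∑∈-mono-< p (λ {y} _ → lym (p - y)) x∈p (lym-< chain) ⟩
      ∑[ y ∈ p ] (∣ p - y ∣ !)   ≤⟨ ∑∈∣p-x∣!≤∣p∣! p ⟩
      ∣ p ∣ !                    ∎
      where open ≤-Reasoning

    sperner-< : (∃ λ i → ¬ Middle n ∣ A i ∣) ⊎ AvoidingChain ⊤ → m < n C ⌊ n /2⌋
    sperner-< nonMiddle⊎avoiding = *-cancelʳ-< middle m (n C ⌊ n /2⌋) (begin-strict
      m * middle              ≡⟨ ∑-const m middle ⟨
      ∑[ i < m ] middle       <⟨ ∑middle<∣⊤∣! nonMiddle⊎avoiding ⟩
      ∣ ⊤ {n} ∣ !             ≡⟨ cong _! (∣⊤∣≡n n) ⟩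
      n !                     ≡⟨ nC⌊n/2⌋*middle≡n! n ⟨
      (n C ⌊ n /2⌋) * middle  ∎)
      where
      open ≤-Reasoning
      middle : ℕ
      middle = ⌊ n /2⌋ ! * ⌈ n /2⌉ !
      middle≤ : ∀ i → middle ≤ chains (A i) ⊤
      middle≤ i = middle≤chains-⊤ (A i)
      ∑middle<∣⊤∣! : (∃ λ i → ¬ Middle n ∣ A i ∣) ⊎ AvoidingChain ⊤ → ∑[ i < m ] middle < ∣ ⊤ {n} ∣ !
      ∑middle<∣⊤∣! (inj₁ (i , ¬middle)) = <-≤-trans (∑-mono-< {j = i} middle≤ (middle<chains-⊤ {p = A i} ¬middle)) (lym ⊤)
      ∑middle<∣⊤∣! (inj₂ chain)         = ≤-<-trans (∑-mono-≤ middle≤) (lym-< chain)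

  module _ {k} (sizes : ∀ i → k ≤ ∣ A i ∣ × ∣ A i ∣ ≤ suc k)
           {s w} (w∉s : w ∉ s) (∣s∣≡k : ∣ s ∣ ≡ k)
           (s-avoids : Avoids s) (s+w-avoids : Avoids (s ∪ ⁅ w ⁆)) where

    private
      w∈s+w : w ∈ s ∪ ⁅ w ⁆
      w∈s+w = q⊆p∪q s ⁅ w ⁆ (x∈⁅x⁆ w)

      s+w-w⊆s : (s ∪ ⁅ w ⁆) - w ⊆ s
      s+w-w⊆s y∈ with x∈p∪q⁻ s ⁅ w ⁆ (p─q⊆p _ ⁅ w ⁆ y∈)
      ... | inj₁ y∈s = y∈s
      ... | inj₂ y∈⁅w⁆ = contradiction y∈⁅w⁆ (x∈p─q⇒x∉q y∈)

      avoids-⊆ : ∀ {p} → p ⊆ s → Avoids p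
      avoids-⊆ p⊆s i Ai≡p with ⊆⇒≡⊎⊂ p⊆s
      ... | inj₁ p≡s = s-avoids i (trans Ai≡p p≡s)
      ... | inj₂ p⊂s = <⇒≱ (subst (_ <_) ∣s∣≡k (p⊂q⇒∣p∣<∣q∣ p⊂s)) (subst (k ≤_) (cong ∣_∣ Ai≡p) (proj₁ (sizes i)))

      avoids-⊇ : ∀ {p} → s ∪ ⁅ w ⁆ ⊆ p → Avoids p
      avoids-⊇ {p} s+w⊆p i Ai≡p with ⊆⇒≡⊎⊂ s+w⊆p
      ... | inj₁ s+w≡p = s+w-avoids i (trans Ai≡p (≡.sym s+w≡p))
      ... | inj₂ s+w⊂p = <⇒≱ (subst (_< ∣ p ∣) ∣s+w∣≡suc[k] (p⊂q⇒∣p∣<∣q∣ s+w⊂p))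
                             (subst (_≤ suc k) (cong ∣_∣ Ai≡p) (proj₂ (sizes i)))
        where
        ∣s+w∣≡suc[k] : ∣ s ∪ ⁅ w ⁆ ∣ ≡ suc k
        ∣s+w∣≡suc[k] = trans (x∉p⇒∣p∪⁅x⁆∣≡suc∣p∣ w∉s) (cong suc ∣s∣≡k)

      chain-⊆ : ∀ {p} → Acc _⊂_ p → p ⊆ s → AvoidingChain p
      chain-⊆ {p} (acc rs) p⊆s with nonempty? p
      ... | no p-empty    = done p-empty (avoids-⊆ p⊆s)
      ... | yes (x , x∈p) = step x∈p (avoids-⊆ p⊆s)
                                 (chain-⊆ (rs (x∈p⇒p-x⊂p x∈p)) (⊆-trans (p─q⊆p p ⁅ x ⁆) p⊆s))

      chain-⊇ : ∀ {p} → Acc _⊂_ p → s ∪ ⁅ w ⁆ ⊆ p → AvoidingChain p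
      chain-⊇ {p} (acc rs) s+w⊆p with ⊆⇒≡⊎⊂ s+w⊆p
      ... | inj₁ refl = step w∈s+w s+w-avoids (chain-⊆ (rs (x∈p⇒p-x⊂p w∈s+w)) s+w-w⊆s)
      ... | inj₂ (_ , x , x∈p , x∉s+w) = step x∈p (avoids-⊇ s+w⊆p) (chain-⊇ (rs (x∈p⇒p-x⊂p x∈p)) s+w⊆p-x)
        where
        s+w⊆p-x : s ∪ ⁅ w ⁆ ⊆ p - x
        s+w⊆p-x y∈ = x∈p∧x≢y⇒x∈p-y (s+w⊆p y∈) λ { refl → x∉s+w y∈ }

    avoidingChain-⊤ : AvoidingChain ⊤
    avoidingChain-⊤ = chain-⊇ (⊂-wellFounded ⊤) ⊆⊤

∃-argmin : ∀ {n} (f : Fin n → ℕ) → Fin n → ∃ λ a → ∀ v → f a ≤ f v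
∃-argmin {n} f v₀ = argmin f v₀ (allFin n) , λ v → All.lookup (f[argmin]≤f[xs] v₀ (allFin n)) (∈-allFin v)

lookup-injective : ∀ {a} {A : Set a} {xs : List A} → Unique xs → ∀ i j → lookup xs i ≡ lookup xs j → i ≡ j
lookup-injective {xs = _ ∷ _} _            zero    zero    _  = refl
lookup-injective {xs = _ ∷ _} (x∉xs ∷ _)   zero    (suc j) eq = contradiction eq (All.lookup x∉xs (∈-lookup j))
lookup-injective {xs = _ ∷ _} (x∉xs ∷ _)   (suc i) zero    eq = contradiction (≡.sym eq) (All.lookup x∉xs (∈-lookup i))
lookup-injective {xs = _ ∷ _} (_ ∷ unique) (suc i) (suc j) eq = cong suc (lookup-injective unique i j eq)

-- Forts

module _ {n} (G : Graph n) where

  adjacent-sym : ∀ {u v} → v ∈ N G u → u ∈ N G v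
  adjacent-sym = Graph.sym G _ _

  adjacent⇒≢ : ∀ {u v} → v ∈ N G u → v ≢ u
  adjacent⇒≢ {u} v∈Nu refl = irrefl G u v∈Nu

  closedNeighbourhood : Fin n → Subset n
  closedNeighbourhood v = N G v ∪ ⁅ v ⁆

  nonNeighbours : Fin n → Subset n
  nonNeighbours v = ∁ (N G v) - v

  Twins : Fin n → Fin n → Set
  Twins a u = u ∈ N G a × closedNeighbourhood a ≡ closedNeighbourhood u

  twins? : ∀ a u → Dec (Twins a u)
  twins? a u = (u ∈? N G a) ×-dec (closedNeighbourhood a ≟ˢ closedNeighbourhood u)

  twins-sym : ∀ {a u} → Twins a u → Twins u a
  twins-sym (u∈Na , N[a]≡N[u]) = adjacent-sym u∈Na , ≡.sym N[a]≡N[u]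

  twin-adjacent : ∀ {a u v} → Twins a u → v ≢ u → a ∈ N G v → u ∈ N G v
  twin-adjacent {a} {u} {v} (_ , N[a]≡N[u]) v≢u a∈Nv
    with x∈p∪q⁻ (N G u) ⁅ u ⁆ (subst (v ∈_) N[a]≡N[u] (p⊆p∪q ⁅ a ⁆ (adjacent-sym a∈Nv)))
  ... | inj₁ v∈Nu  = adjacent-sym v∈Nu
  ... | inj₂ v∈⁅u⁆ = contradiction (x∈⁅y⁆⇒x≡y u v∈⁅u⁆) v≢u

  fort⊂⇒¬minimal : ∀ {t p} → IsFort G t → t ⊂ p → ¬ IsMinimalFort G p
  fort⊂⇒¬minimal fort-t t⊂p (_ , minimal) = minimal _ t⊂p fort-t

  minimalForts-⊆⇒≡ : ∀ {p q} → IsMinimalFort G p → IsMinimalFort G q → p ⊆ q → p ≡ q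
  minimalForts-⊆⇒≡ (fort-p , _) (_ , minimal-q) p⊆q with ⊆⇒≡⊎⊂ p⊆q
  ... | inj₁ p≡q = p≡q
  ... | inj₂ p⊂q = contradiction fort-p (minimal-q _ p⊂q)

  loneNeighbour⇒¬fort : ∀ {a v p} → a ∉ p → v ∈ N G a → v ∈ p →
                        (∀ {y} → y ∈ N G a → y ∈ p → y ≡ v) → ¬ IsFort G p
  loneNeighbour⇒¬fort {a} {v} {p} a∉p v∈Na v∈p unique (_ , noLoneNeighbour) =
    noLoneNeighbour a a∉p (∃!⇒∣p∣≡1 (v , x∈p∩q⁺ (v∈Na , v∈p) , onlyV))
    where
    onlyV : ∀ {y} → y ∈ N G a ∩ p → v ≡ y
    onlyV y∈ = let y∈Na , y∈p = x∈p∩q⁻ (N G a) p y∈ in ≡.sym (unique y∈Na y∈p)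

  isolated⇒fort : ∀ {a} → (∀ v → v ∉ N G a) → IsFort G ⁅ a ⁆
  isolated⇒fort {a} isolated = (a , x∈⁅x⁆ a) , noLoneNeighbour
    where
    noLoneNeighbour : ∀ u → u ∉ ⁅ a ⁆ → ∣ N G u ∩ ⁅ a ⁆ ∣ ≢ 1
    noLoneNeighbour u _ ∣Nu∩a∣≡1 =
      let x , x∈Nu∩a , _ = ∣p∣≡1⇒∃! ∣Nu∩a∣≡1
          x∈Nu , x∈⁅a⁆   = x∈p∩q⁻ (N G u) ⁅ a ⁆ x∈Nu∩a
      in  isolated u (adjacent-sym (subst (_∈ N G u) (x∈⁅y⁆⇒x≡y a x∈⁅a⁆) x∈Nu))

  twins⇒fort : ∀ {a u} → Twins a u → IsFort G (⁅ a ⁆ ∪ ⁅ u ⁆)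
  twins⇒fort {a} {u} twins = (a , a∈t) , noLoneNeighbour
    where
    t : Subset n
    t = ⁅ a ⁆ ∪ ⁅ u ⁆
    a∈t : a ∈ t
    a∈t = p⊆p∪q ⁅ u ⁆ (x∈⁅x⁆ a)
    u∈t : u ∈ t
    u∈t = q⊆p∪q ⁅ a ⁆ ⁅ u ⁆ (x∈⁅x⁆ u)
    both-adjacent : ∀ {v x} → v ∉ t → x ∈ t → x ∈ N G v → a ∈ N G v × u ∈ N G v
    both-adjacent v∉t x∈t x∈Nv with x∈p∪q⁻ ⁅ a ⁆ ⁅ u ⁆ x∈t
    ... | inj₁ x∈⁅a⁆ = let a∈Nv = subst (_∈ N G _) (x∈⁅y⁆⇒x≡y a x∈⁅a⁆) x∈Nv
                       in  a∈Nv , twin-adjacent twins (λ { refl → v∉t u∈t }) a∈Nv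
    ... | inj₂ x∈⁅u⁆ = let u∈Nv = subst (_∈ N G _) (x∈⁅y⁆⇒x≡y u x∈⁅u⁆) x∈Nv
                       in  twin-adjacent (twins-sym twins) (λ { refl → v∉t a∈t }) u∈Nv , u∈Nv
    noLoneNeighbour : ∀ v → v ∉ t → ∣ N G v ∩ t ∣ ≢ 1
    noLoneNeighbour v v∉t ∣Nv∩t∣≡1 =
      let x , x∈Nv∩t , unique = ∣p∣≡1⇒∃! ∣Nv∩t∣≡1
          x∈Nv , x∈t          = x∈p∩q⁻ (N G v) t x∈Nv∩t
          a∈Nv , u∈Nv         = both-adjacent v∉t x∈t x∈Nv
      in  adjacent⇒≢ (proj₁ twins) (trans (≡.sym (unique (x∈p∩q⁺ (u∈Nv , u∈t)))) (unique (x∈p∩q⁺ (a∈Nv , a∈t))))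

  -- A neighbour v of a whose only neighbour outside N(a) is a has N[v] ⊆ N[a]; as deg a is
  -- minimal, N[v] = N[a] and v would be a twin of a.
  minDegree⇒fort : ∀ {a} → (∀ v → ∣ N G a ∣ ≤ ∣ N G v ∣) → (∀ u → ¬ Twins a u) → IsFort G (∁ (N G a))
  minDegree⇒fort {a} minDegree twinFree = (a , a∈∁Na) , noLoneNeighbour
    where
    a∈∁Na : a ∈ ∁ (N G a)
    a∈∁Na = x∉p⇒x∈∁p (irrefl G a)
    ∣N[v]∣≡suc∣Nv∣ : ∀ v → ∣ closedNeighbourhood v ∣ ≡ suc ∣ N G v ∣
    ∣N[v]∣≡suc∣Nv∣ v = x∉p⇒∣p∪⁅x⁆∣≡suc∣p∣ (irrefl G v)
    noLoneNeighbour : ∀ v → v ∉ ∁ (N G a) → ∣ N G v ∩ ∁ (N G a) ∣ ≢ 1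
    noLoneNeighbour v v∉∁Na ∣Nv∩∁Na∣≡1 = twinFree v (v∈Na , ≡.sym N[v]≡N[a])
      where
      v∈Na : v ∈ N G a
      v∈Na = x∉∁p⇒x∈p v∉∁Na
      onlyA : ∀ {y} → y ∈ N G v → y ∉ N G a → y ≡ a
      onlyA y∈Nv y∉Na =
        let _ , _ , unique = ∣p∣≡1⇒∃! ∣Nv∩∁Na∣≡1
        in  trans (≡.sym (unique (x∈p∩q⁺ (y∈Nv , x∉p⇒x∈∁p y∉Na)))) (unique (x∈p∩q⁺ (adjacent-sym v∈Na , a∈∁Na)))
      N[v]⊆N[a] : closedNeighbourhood v ⊆ closedNeighbourhood a
      N[v]⊆N[a] {y} y∈N[v] with x∈p∪q⁻ (N G v) ⁅ v ⁆ y∈N[v] | y ∈? N G a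
      ... | inj₂ y∈⁅v⁆ | _        = p⊆p∪q ⁅ a ⁆ (subst (_∈ N G a) (≡.sym (x∈⁅y⁆⇒x≡y v y∈⁅v⁆)) v∈Na)
      ... | inj₁ _     | yes y∈Na = p⊆p∪q ⁅ a ⁆ y∈Na
      ... | inj₁ y∈Nv  | no y∉Na  = q⊆p∪q (N G a) ⁅ a ⁆ (subst (_∈ ⁅ a ⁆) (≡.sym (onlyA y∈Nv y∉Na)) (x∈⁅x⁆ a))
      N[v]≡N[a] : closedNeighbourhood v ≡ closedNeighbourhood a
      N[v]≡N[a] = p⊆q∧∣q∣≤∣p∣⇒p≡q N[v]⊆N[a]
                    (≡.subst₂ _≤_ (≡.sym (∣N[v]∣≡suc∣Nv∣ a)) (≡.sym (∣N[v]∣≡suc∣Nv∣ v)) (s≤s (minDegree v)))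

  a∉nonNeighbours∪⁅v⁆ : ∀ {a v} → v ∈ N G a → a ∉ nonNeighbours a ∪ ⁅ v ⁆
  a∉nonNeighbours∪⁅v⁆ {a} {v} v∈Na a∈ with x∈p∪q⁻ (nonNeighbours a) ⁅ v ⁆ a∈
  ... | inj₁ a∈nonNa = x∈p─q⇒x∉q a∈nonNa (x∈⁅x⁆ a)
  ... | inj₂ a∈⁅v⁆   = adjacent⇒≢ v∈Na (≡.sym (x∈⁅y⁆⇒x≡y v a∈⁅v⁆))

  ∣nonNeighbours∪⁅v⁆∣ : ∀ {a v} → v ∈ N G a → ∣ nonNeighbours a ∪ ⁅ v ⁆ ∣ ≡ ∣ ∁ (N G a) ∣
  ∣nonNeighbours∪⁅v⁆∣ {a} {v} v∈Na =
    trans (x∉p⇒∣p∪⁅x⁆∣≡suc∣p∣ v∉nonNa) (x∈p⇒suc∣p-x∣≡∣p∣ (x∉p⇒x∈∁p (irrefl G a)))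
    where
    v∉nonNa : v ∉ nonNeighbours a
    v∉nonNa v∈nonNa = x∈∁p⇒x∉p (p─q⊆p _ ⁅ a ⁆ v∈nonNa) v∈Na

  ⊆nonNeighbours∪⁅v⁆⇒¬fort : ∀ {a v p} → v ∈ N G a → v ∈ p → p ⊆ nonNeighbours a ∪ ⁅ v ⁆ → ¬ IsFort G p
  ⊆nonNeighbours∪⁅v⁆⇒¬fort {a} {v} {p} v∈Na v∈p p⊆ =
    loneNeighbour⇒¬fort (a∉nonNeighbours∪⁅v⁆ v∈Na ∘ p⊆) v∈Na v∈p onlyV
    where
    onlyV : ∀ {y} → y ∈ N G a → y ∈ p → y ≡ v
    onlyV y∈Na y∈p with x∈p∪q⁻ (nonNeighbours a) ⁅ v ⁆ (p⊆ y∈p)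
    ... | inj₁ y∈nonNa = contradiction y∈Na (x∈∁p⇒x∉p (p─q⊆p _ ⁅ a ⁆ y∈nonNa))
    ... | inj₂ y∈⁅v⁆   = x∈⁅y⁆⇒x≡y v y∈⁅v⁆

  record MinimalFortFreeEdge (k : ℕ) : Set where
    constructor edge
    field
      lower            : Subset n
      new              : Fin n
      new∉lower        : new ∉ lower
      ∣lower∣≡k        : ∣ lower ∣ ≡ k
      lower-notMinimal : ¬ IsMinimalFort G lower
      upper-notMinimal : ¬ IsMinimalFort G (lower ∪ ⁅ new ⁆)

  smallFort⇒edge : ∀ {t k} → IsFort G t → ∣ t ∣ < k → k < n → MinimalFortFreeEdge k
  smallFort⇒edge {t} {k} fort-t ∣t∣<k k<n = fromMissing (p⊆q∧∣p∣<∣q∣⇒p⊂q ⊆⊤ ∣t∣<∣⊤∣)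
    where
    ∣t∣<∣⊤∣ : ∣ t ∣ < ∣ ⊤ {n} ∣
    ∣t∣<∣⊤∣ = <-trans ∣t∣<k (subst (k <_) (≡.sym (∣⊤∣≡n n)) k<n)
    fromMissing : t ⊂ ⊤ → MinimalFortFreeEdge k
    fromMissing (_ , w , _ , w∉t) = extend (⊆-fill t⊆⊤-w (<⇒≤ ∣t∣<k) k≤∣⊤-w∣)
      where
      t⊆⊤-w : t ⊆ ⊤ - w
      t⊆⊤-w y∈t = x∈p∧x≢y⇒x∈p-y ∈⊤ λ { refl → w∉t y∈t }
      k≤∣⊤-w∣ : k ≤ ∣ ⊤ - w ∣
      k≤∣⊤-w∣ = ≤-pred (subst (k <_) (≡.sym (trans (x∈p⇒suc∣p-x∣≡∣p∣ (∈⊤ {x = w})) (∣⊤∣≡n n))) k<n)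
      extend : (∃ λ s → t ⊆ s × s ⊆ ⊤ - w × ∣ s ∣ ≡ k) → MinimalFortFreeEdge k
      extend (s , t⊆s , s⊆⊤-w , ∣s∣≡k) = edge s w w∉s ∣s∣≡k (fort⊂⇒¬minimal fort-t t⊂s) (fort⊂⇒¬minimal fort-t t⊂s+w)
        where
        w∉s : w ∉ s
        w∉s w∈s = x∈p─q⇒x∉q (s⊆⊤-w w∈s) (x∈⁅x⁆ w)
        t⊂s : t ⊂ s
        t⊂s = p⊆q∧∣p∣<∣q∣⇒p⊂q t⊆s (subst (∣ t ∣ <_) (≡.sym ∣s∣≡k) ∣t∣<k)
        t⊂s+w : t ⊂ s ∪ ⁅ w ⁆
        t⊂s+w = (λ y∈t → p⊆p∪q ⁅ w ⁆ (t⊆s y∈t)) , w , q⊆p∪q s ⁅ w ⁆ (x∈⁅x⁆ w) , w∉t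

  complementFort⇒edge : ∀ {a v k} → IsFort G (∁ (N G a)) → v ∈ N G a → ∣ ∁ (N G a) ∣ ≡ k → MinimalFortFreeEdge k
  complementFort⇒edge {a} {v} {k} fort-∁Na v∈Na ∣∁Na∣≡k =
    edge s a (a∉nonNeighbours∪⁅v⁆ v∈Na) (trans (∣nonNeighbours∪⁅v⁆∣ v∈Na) ∣∁Na∣≡k)
         (⊆nonNeighbours∪⁅v⁆⇒¬fort v∈Na v∈s ⊆-refl ∘ proj₁)
         (fort⊂⇒¬minimal fort-∁Na (∁Na⊆s+a , v , p⊆p∪q ⁅ a ⁆ v∈s , x∈p⇒x∉∁p v∈Na))
    where
    s : Subset n
    s = nonNeighbours a ∪ ⁅ v ⁆
    v∈s : v ∈ s
    v∈s = q⊆p∪q (nonNeighbours a) ⁅ v ⁆ (x∈⁅x⁆ v)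
    ∁Na⊆s+a : ∁ (N G a) ⊆ s ∪ ⁅ a ⁆
    ∁Na⊆s+a {y} y∈∁Na with y ≟ᶠ a
    ... | yes refl = q⊆p∪q s ⁅ a ⁆ (x∈⁅x⁆ a)
    ... | no y≢a   = p⊆p∪q ⁅ a ⁆ (p⊆p∪q ⁅ v ⁆ (x∈p∧x≢y⇒x∈p-y y∈∁Na y≢a))

  loneNeighbour⇒edge : ∀ {a v k} → v ∈ N G a → 1 ≤ k → k < ∣ ∁ (N G a) ∣ → MinimalFortFreeEdge k
  loneNeighbour⇒edge {a} {v} {k} v∈Na 1≤k k<∣∁Na∣ = extend (⊆-fill ⁅v⁆⊆r ∣⁅v⁆∣≤k k≤∣r∣)
    where
    r : Subset n
    r = nonNeighbours a ∪ ⁅ v ⁆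
    ⁅v⁆⊆r : ⁅ v ⁆ ⊆ r
    ⁅v⁆⊆r = q⊆p∪q (nonNeighbours a) ⁅ v ⁆
    ∣⁅v⁆∣≤k : ∣ ⁅ v ⁆ ∣ ≤ k
    ∣⁅v⁆∣≤k = subst (_≤ k) (≡.sym (∣⁅x⁆∣≡1 v)) 1≤k
    k<∣r∣ : k < ∣ r ∣
    k<∣r∣ = subst (k <_) (≡.sym (∣nonNeighbours∪⁅v⁆∣ v∈Na)) k<∣∁Na∣
    k≤∣r∣ : k ≤ ∣ r ∣
    k≤∣r∣ = <⇒≤ k<∣r∣
    extend : (∃ λ s → ⁅ v ⁆ ⊆ s × s ⊆ r × ∣ s ∣ ≡ k) → MinimalFortFreeEdge k
    extend (s , ⁅v⁆⊆s , s⊆r , ∣s∣≡k) = fromMissing (p⊆q∧∣p∣<∣q∣⇒p⊂q s⊆r (subst (_< ∣ r ∣) (≡.sym ∣s∣≡k) k<∣r∣))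
      where
      v∈s : v ∈ s
      v∈s = ⁅v⁆⊆s (x∈⁅x⁆ v)
      fromMissing : s ⊂ r → MinimalFortFreeEdge k
      fromMissing (_ , w , w∈r , w∉s) =
        edge s w w∉s ∣s∣≡k (⊆nonNeighbours∪⁅v⁆⇒¬fort v∈Na v∈s s⊆r ∘ proj₁)
             (⊆nonNeighbours∪⁅v⁆⇒¬fort v∈Na (p⊆p∪q ⁅ w ⁆ v∈s) s+w⊆r ∘ proj₁)
        where
        s+w⊆r : s ∪ ⁅ w ⁆ ⊆ r
        s+w⊆r y∈ with x∈p∪q⁻ s ⁅ w ⁆ y∈
        ... | inj₁ y∈s   = s⊆r y∈s
        ... | inj₂ y∈⁅w⁆ = subst (_∈ r) (≡.sym (x∈⁅y⁆⇒x≡y w y∈⁅w⁆)) w∈r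

  minimalFortFreeEdge : ∀ {k} → 3 ≤ k → k < n → MinimalFortFreeEdge k
  minimalFortFreeEdge {k} 3≤k k<n = atMinDegree (proj₂ (∃-argmin (λ v → ∣ N G v ∣) (fromℕ< k<n)))
    where
    atMinDegree : ∀ {a} → (∀ v → ∣ N G a ∣ ≤ ∣ N G v ∣) → MinimalFortFreeEdge k
    atMinDegree {a} minDegree with any? (λ v → v ∈? N G a) | any? (twins? a)
    ... | no isolated | _ =
      smallFort⇒edge (isolated⇒fort λ v v∈Na → isolated (v , v∈Na))
                     (subst (_< k) (≡.sym (∣⁅x⁆∣≡1 a)) (≤-trans (s≤s (s≤s z≤n)) 3≤k)) k<n
    ... | yes _ | yes (u , twins) =
      smallFort⇒edge (twins⇒fort twins)
                     (subst (_< k) (≡.sym (trans (x∉p⇒∣p∪⁅x⁆∣≡suc∣p∣ u∉⁅a⁆) (cong suc (∣⁅x⁆∣≡1 a)))) 3≤k) k<n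
      where
      u∉⁅a⁆ : u ∉ ⁅ a ⁆
      u∉⁅a⁆ = x≢y⇒x∉⁅y⁆ (adjacent⇒≢ (proj₁ twins))
    ... | yes (v , v∈Na) | no twinFree with <-cmp ∣ ∁ (N G a) ∣ k
    ...   | tri< small _ _ = smallFort⇒edge (minDegree⇒fort minDegree (λ u tw → twinFree (u , tw))) small k<n
    ...   | tri≈ _ exact _ = complementFort⇒edge (minDegree⇒fort minDegree (λ u tw → twinFree (u , tw))) v∈Na exact
    ...   | tri> _ _ large = loneNeighbour⇒edge v∈Na (≤-trans (s≤s z≤n) 3≤k) large

corollary3p4 : (n : ℕ) → 6 ≤ n → (G : Graph n) → (Fs : List (Subset n)) →
    Unique Fs → All (IsMinimalFort G) Fs → length Fs < n C (n / 2)
corollary3p4 n 6≤n G Fs unique allMinimal =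
  subst (λ k → length Fs < n C k) (≡.sym (n/2≡⌊n/2⌋ n)) (sperner-< antichain nonMiddle⊎avoiding)
  where
  open LYM (lookup Fs)
  minimal : ∀ i → IsMinimalFort G (lookup Fs i)
  minimal i = All.lookup allMinimal (∈-lookup i)
  antichain : ∀ i j → lookup Fs i ⊆ lookup Fs j → i ≡ j
  antichain i j Fi⊆Fj = lookup-injective unique i j (minimalForts-⊆⇒≡ G (minimal i) (minimal j) Fi⊆Fj)
  avoids : ∀ {p} → ¬ IsMinimalFort G p → Avoids p
  avoids ¬minimal i Fi≡p = ¬minimal (subst (IsMinimalFort G) Fi≡p (minimal i))
  k : ℕ
  k = ⌊ n /2⌋
  3≤k : 3 ≤ k
  3≤k = ⌊n/2⌋-mono 6≤n
  k<n : k < n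
  k<n = subst (k <_) (⌊n/2⌋+⌈n/2⌉≡n n) (m<m+n k (≤-trans (≤-trans (s≤s z≤n) 3≤k) (⌊n/2⌋≤⌈n/2⌉ n)))
  nonMiddle⊎avoiding : (∃ λ i → ¬ Middle n ∣ lookup Fs i ∣) ⊎ AvoidingChain ⊤
  nonMiddle⊎avoiding with all? (λ i → middle? n ∣ lookup Fs i ∣)
  ... | no notAllMiddle = inj₁ (¬∀⟶∃¬ _ _ (λ i → middle? n ∣ lookup Fs i ∣) notAllMiddle)
  ... | yes allMiddle   =
    let open MinimalFortFreeEdge (minimalFortFreeEdge G 3≤k k<n)
    in  inj₂ (avoidingChain-⊤ (Middle⇒bounds ∘ allMiddle) new∉lower ∣lower∣≡k
                              (avoids lower-notMinimal) (avoids upper-notMinimal))
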